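{- Let $D$ be a nontrivial strongly connected digraph. Then (a) $src^*(D)=1$ if and only if $rc^*(D)=1$, if and only if $D$ is the biorientation of the complete graph $K_n$ for some $n\ge 2$; and (b) $rc^*(D)=2$ if and only if $src^*(D)=2$.
   Context: All digraphs are finite, without loops or multiple arcs; nontrivial means at least two vertices. For an arc-colouring of a strongly connected digraph $D$, a directed path is rainbow if no two of its arcs receive the same colour. An arc-colouring is rainbow connected if for every ordered pair of distinct vertices $x,y$ there is a rainbow directed $xy$-path; $rc^*(D)$ is the minimum number of colours in a rainbow connected arc-colouring. It is strongly rainbow connected if for every ordered pair of distinct vertices $x,y$ there is a rainbow directed $xy$-path of length equal to the directed distance $d_D(x,y)$; $src^*(D)$ is the minimum number of colours in such a colouring. The biorientation of a graph $G$ is the digraph obtained by replacing each edge $uv$ by the two arcs $uv$ and $vu$. -}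

module Defs where

open import Data.Nat using (ℕ; zero; suc; _≤_)
open import Data.Fin using (Fin; _≟_)
open import Data.Bool using (Bool; true; false; T; not)
open import Data.List using (List; []; _∷_; length)
open import Data.List.Relation.Unary.Unique.Propositional using (Unique)
open import Data.Product using (Σ; _×_; _,_)
open import Relation.Binary.PropositionalEquality using (_≡_)
open import Relation.Nullary using (¬_; does)
open import Function.Bundles using (_⤖_; Bijection)

record Digraph : Set where
  field
    n     : ℕ
    arc   : Fin n → Fin n → Bool
    loopless : ∀ x → arc x x ≡ false

open Digraph public

Arc : (D : Digraph) → Fin (n D) → Fin (n D) → Set
Arc D x y = T (arc D x y)

record Graph : Set where
  field
    m     : ℕ
    adj   : Fin m → Fin m → Bool
    irrefl : ∀ x → adj x x ≡ false
    adj-sym : ∀ x y → adj x y ≡ adj y x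

open Graph public

-- Biorientation: each edge uv becomes the two arcs uv and vu.
biorientation : Graph → Digraph
biorientation G = record { n = m G ; arc = adj G ; loopless = irrefl G }

complete : ℕ → Graph
complete k = record
  { m = k
  ; adj = λ x y → not (does (x ≟ y))
  ; irrefl = irr
  ; adj-sym = sy
  }
  where
  open import Relation.Binary.PropositionalEquality using (refl) renaming (sym to ≡-sym)
  open import Relation.Nullary using (yes; no)
  open import Data.Empty using (⊥-elim)
  irr : ∀ x → not (does (x ≟ x)) ≡ false
  irr x with x ≟ x
  ... | yes _ = refl
  ... | no ne = ⊥-elim (ne refl)
  sy : ∀ x y → not (does (x ≟ y)) ≡ not (does (y ≟ x))
  sy x y with x ≟ y | y ≟ x
  ... | yes _ | yes _ = refl
  ... | no _ | no _ = refl
  ... | yes p | no q = ⊥-elim (q (≡-sym p))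
  ... | no p | yes q = ⊥-elim (p (≡-sym q))

_≅_ : Digraph → Digraph → Set
D ≅ E = Σ (Fin (n D) ⤖ Fin (n E)) λ f →
  ∀ x y → arc D x y ≡ arc E (Bijection.to f x) (Bijection.to f y)

data Walk (D : Digraph) : Fin (n D) → Fin (n D) → Set where
  []  : ∀ {x} → Walk D x x
  _∷_ : ∀ {x y z} → Arc D x y → Walk D y z → Walk D x z

lengthW : ∀ {D x y} → Walk D x y → ℕ
lengthW [] = 0
lengthW (_ ∷ w) = suc (lengthW w)

vertices : ∀ {D x y} → Walk D x y → List (Fin (n D))
vertices {x = x} [] = x ∷ []
vertices {x = x} (_ ∷ w) = x ∷ vertices w

IsPath : ∀ {D x y} → Walk D x y → Set
IsPath w = Unique (vertices w)

Nontrivial : Digraph → Set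
Nontrivial D = 2 ≤ n D

StronglyConnected : Digraph → Set
StronglyConnected D = ∀ x y → Σ (Walk D x y) IsPath

-- An arc-colouring with (at most) k colours; only values on arcs matter.
Colouring : Digraph → ℕ → Set
Colouring D k = Fin (n D) → Fin (n D) → Fin k

colours : ∀ {D k x y} → Colouring D k → Walk D x y → List (Fin k)
colours c [] = []
colours {x = x} c (_∷_ {y = y} _ w) = c x y ∷ colours c w

Rainbow : ∀ {D k x y} → Colouring D k → Walk D x y → Set
Rainbow c w = Unique (colours c w)

RainbowConnected : (D : Digraph) (k : ℕ) → Colouring D k → Set
RainbowConnected D k c = ∀ x y → ¬ x ≡ y →
  Σ (Walk D x y) λ w → IsPath w × Rainbow c w

Geodesic : ∀ {D x y} → Walk D x y → Set
Geodesic {D} {x} {y} w = IsPath w × (∀ (v : Walk D x y) → IsPath v → lengthW w ≤ lengthW v)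

StronglyRainbowConnected : (D : Digraph) (k : ℕ) → Colouring D k → Set
StronglyRainbowConnected D k c = ∀ x y → ¬ x ≡ y →
  Σ (Walk D x y) λ w → Geodesic w × Rainbow c w

RC* : Digraph → ℕ → Set
RC* D k = Σ (Colouring D k) (RainbowConnected D k)
        × (∀ j → Σ (Colouring D j) (RainbowConnected D j) → k ≤ j)

SRC* : Digraph → ℕ → Set
SRC* D k = Σ (Colouring D k) (StronglyRainbowConnected D k)
         × (∀ j → Σ (Colouring D j) (StronglyRainbowConnected D j) → k ≤ j)

-- With at most two colours a rainbow path has length at most two, and a pair
-- of vertices at distance at least two admits no shorter path, so every rainbow
-- path is then already geodesic: rainbow and strong rainbow connectivity coincide
-- for one and two colours. With one colour a rainbow path is a single arc, so
-- rc*(D) = 1 forces every ordered pair of distinct vertices to be an arc.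
module Submission where

open import Defs
open import Data.Nat as ℕ using (ℕ; _≤_; z≤n; s≤s; >-nonZero⁻¹)
open import Data.Nat.Properties using (≤-trans; <⇒≤; ≰⇒>; _≤?_)
open import Data.Fin using (Fin; zero; suc; _≟_; fromℕ<)
open import Data.Fin.Properties using (injective⇒≤; nonZeroIndex)
open import Data.Bool using (T; not)
open import Data.Bool.Properties using (T-≡)
open import Data.Unit using (tt)
open import Data.List using (List; length; lookup)
open import Data.List.Membership.Propositional.Properties using (∈-lookup)
open import Data.List.Relation.Unary.All as All using ([]; _∷_)
open import Data.List.Relation.Unary.AllPairs using ([]; _∷_)
open import Data.List.Relation.Unary.Unique.Propositional using (Unique)
open import Data.Product using (Σ; _×_; _,_)
open import Function.Base using (_∘_)
open import Function.Bundles using (_⇔_; mk⇔; Bijection; Equivalence)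
open import Function.Construct.Identity using (⤖-id)
open import Function.Definitions using (Injective)
import Function.Properties.Equivalence as ⇔
open import Relation.Binary.PropositionalEquality using (_≡_; refl; sym; cong; subst)
open import Relation.Nullary using (¬_; yes; no; does; contradiction)
open import Relation.Nullary.Decidable using (T?; dec-false)

private
  variable
    A : Set
    k j : ℕ

unique-lookup-injective : {xs : List A} → Unique xs → Injective _≡_ _≡_ (lookup xs)
unique-lookup-injective (_ ∷ _) {zero} {zero} _ = refl
unique-lookup-injective (x∉xs ∷ _) {zero} {suc j} eq = contradiction eq (All.lookup x∉xs (∈-lookup j))
unique-lookup-injective (x∉xs ∷ _) {suc i} {zero} eq = contradiction (sym eq) (All.lookup x∉xs (∈-lookup i))
unique-lookup-injective (_ ∷ xs!) {suc i} {suc j} eq = cong suc (unique-lookup-injective xs! eq)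

unique-length≤ : {xs : List (Fin k)} → Unique xs → length xs ≤ k
unique-length≤ xs! = injective⇒≤ (unique-lookup-injective xs!)

Complete : Digraph → Set
Complete D = ∀ x y → ¬ x ≡ y → Arc D x y

BiorientedComplete : Digraph → Set
BiorientedComplete D = Σ ℕ λ k → 2 ≤ k × D ≅ biorientation (complete k)

complete-arc : ∀ {k} {x y : Fin k} → ¬ x ≡ y → Arc (biorientation (complete k)) x y
complete-arc {x = x} {y} x≢y = subst (T ∘ not) (sym (dec-false (x ≟ y) x≢y)) tt

module _ {D : Digraph} where

  length-colours : ∀ {x y} (c : Colouring D k) (w : Walk D x y) → length (colours c w) ≡ lengthW w
  length-colours c [] = refl
  length-colours c (_ ∷ w) = cong ℕ.suc (length-colours c w)

  rainbow-length≤ : ∀ {x y} (c : Colouring D k) (w : Walk D x y) → Rainbow c w → lengthW w ≤ k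
  rainbow-length≤ {k} c w rainbow = subst (_≤ k) (length-colours c w) (unique-length≤ rainbow)

  arc-walk : ∀ {x y} → Arc D x y → Walk D x y
  arc-walk a = a ∷ []

  arc-isPath : ∀ {x y} → ¬ x ≡ y → (a : Arc D x y) → IsPath (arc-walk a)
  arc-isPath x≢y _ = (x≢y ∷ []) ∷ [] ∷ []

  arc-rainbow : ∀ {x y} (c : Colouring D k) (a : Arc D x y) → Rainbow c (arc-walk a)
  arc-rainbow _ _ = [] ∷ []

  distinct⇒length≥1 : ∀ {x y} → ¬ x ≡ y → (w : Walk D x y) → 1 ≤ lengthW w
  distinct⇒length≥1 x≢y [] = contradiction refl x≢y
  distinct⇒length≥1 _   (_ ∷ _) = s≤s z≤n

  nonArc⇒length≥2 : ∀ {x y} → ¬ x ≡ y → ¬ Arc D x y → (w : Walk D x y) → 2 ≤ lengthW w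
  nonArc⇒length≥2 x≢y _  [] = contradiction refl x≢y
  nonArc⇒length≥2 _   ¬a (a ∷ []) = contradiction a ¬a
  nonArc⇒length≥2 _   _  (_ ∷ _ ∷ _) = s≤s (s≤s z≤n)

  length≤1⇒arc : ∀ {x y} → ¬ x ≡ y → (w : Walk D x y) → lengthW w ≤ 1 → Arc D x y
  length≤1⇒arc x≢y [] _ = contradiction refl x≢y
  length≤1⇒arc _   (a ∷ []) _ = a
  length≤1⇒arc _   (_ ∷ _ ∷ _) (s≤s ())

  arc-geodesic : ∀ {x y} → ¬ x ≡ y → (a : Arc D x y) → Geodesic (arc-walk a)
  arc-geodesic x≢y a = arc-isPath x≢y a , λ v _ → distinct⇒length≥1 x≢y v

  stronglyRainbowConnected⇒rainbowConnected : (c : Colouring D k) →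
    StronglyRainbowConnected D k c → RainbowConnected D k c
  stronglyRainbowConnected⇒rainbowConnected c src x y x≢y =
    let w , (path , _) , rainbow = src x y x≢y in w , path , rainbow

  rainbowConnected⇒stronglyRainbowConnected : k ≤ 2 → (c : Colouring D k) →
    RainbowConnected D k c → StronglyRainbowConnected D k c
  rainbowConnected⇒stronglyRainbowConnected {k} k≤2 c rc x y x≢y with T? (arc D x y)
  ... | yes a = arc-walk a , arc-geodesic x≢y a , arc-rainbow c a
  ... | no ¬a with rc x y x≢y
  ...   | w , path , rainbow = w , (path , shortest) , rainbow
    where
    shortest : ∀ v → IsPath v → lengthW w ≤ lengthW v
    shortest v _ = ≤-trans (≤-trans (rainbow-length≤ c w rainbow) k≤2) (nonArc⇒length≥2 x≢y ¬a v)

  RC*⇔SRC* : k ≤ 2 → RC* D k ⇔ SRC* D k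
  RC*⇔SRC* {k} k≤2 = mk⇔ to from
    where
    to : RC* D k → SRC* D k
    to ((c , rc) , minimal) =
      (c , rainbowConnected⇒stronglyRainbowConnected k≤2 c rc) ,
      λ j (c′ , src) → minimal j (c′ , stronglyRainbowConnected⇒rainbowConnected c′ src)

    from : SRC* D k → RC* D k
    from ((c , src) , minimal) = (c , stronglyRainbowConnected⇒rainbowConnected c src) , minimal′
      where
      minimal′ : ∀ j → Σ (Colouring D j) (RainbowConnected D j) → k ≤ j
      minimal′ j (c′ , rc) with j ≤? 2
      ... | yes j≤2 = minimal j (c′ , rainbowConnected⇒stronglyRainbowConnected j≤2 c′ rc)
      ... | no j≰2 = ≤-trans k≤2 (<⇒≤ (≰⇒> j≰2))

  complete⇒≅K : Complete D → D ≅ biorientation (complete (n D))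
  complete⇒≅K adjacent = ⤖-id (Fin (n D)) , arc-complete
    where
    arc-complete : ∀ x y → arc D x y ≡ not (does (x ≟ y))
    arc-complete x y with x ≟ y
    ... | yes refl = loopless D x
    ... | no x≢y = Equivalence.to T-≡ (adjacent x y x≢y)

  ≅K⇒complete : ∀ {k} → D ≅ biorientation (complete k) → Complete D
  ≅K⇒complete (f , preserves) x y x≢y =
    subst T (sym (preserves x y)) (complete-arc (x≢y ∘ Bijection.injective f))

  rainbowConnected₁⇒complete : (c : Colouring D 1) → RainbowConnected D 1 c → Complete D
  rainbowConnected₁⇒complete c rc x y x≢y =
    let w , _ , rainbow = rc x y x≢y in length≤1⇒arc x≢y w (rainbow-length≤ c w rainbow)

  complete⇒rainbowConnected₁ : Complete D → RainbowConnected D 1 (λ _ _ → zero)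
  complete⇒rainbowConnected₁ adjacent x y x≢y =
    arc-walk (adjacent x y x≢y) , arc-isPath x≢y (adjacent x y x≢y) , arc-rainbow _ (adjacent x y x≢y)

  colouring⇒1≤ : Nontrivial D → Colouring D j → 1 ≤ j
  colouring⇒1≤ {j} nontrivial c = >-nonZero⁻¹ j {{nonZeroIndex (c v v)}}
    where
    v : Fin (n D)
    v = fromℕ< nontrivial

  RC*₁⇔biorientedComplete : Nontrivial D → RC* D 1 ⇔ BiorientedComplete D
  RC*₁⇔biorientedComplete nontrivial = mk⇔ to from
    where
    to : RC* D 1 → BiorientedComplete D
    to ((c , rc) , _) = n D , nontrivial , complete⇒≅K (rainbowConnected₁⇒complete c rc)

    from : BiorientedComplete D → RC* D 1
    from (_ , _ , iso) =
      (_ , complete⇒rainbowConnected₁ (≅K⇒complete iso)) ,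
      λ j (c , _) → colouring⇒1≤ nontrivial c

-- Strong connectivity, assumed in the paper so that rc* and src* exist, is not
-- needed for the equivalences.
theorem2 : (D : Digraph) → Nontrivial D → StronglyConnected D →
    ((SRC* D 1 ⇔ RC* D 1) × (RC* D 1 ⇔ Σ ℕ (λ k → 2 ≤ k × D ≅ biorientation (complete k))))
    × (RC* D 2 ⇔ SRC* D 2)
theorem2 D nontrivial _ =
  (⇔.sym (RC*⇔SRC* (s≤s z≤n)) , RC*₁⇔biorientedComplete nontrivial) , RC*⇔SRC* (s≤s (s≤s z≤n))
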